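{- Let $p$ be a propositional variable and, for positive integers $n,k$, let $\beta_n=\Diamond\Box\perp\wedge\Diamond^n\Diamond\Box\perp\wedge\bigwedge_{k=2}^{n-1}\neg\Diamond^k\Diamond\Box\perp$, $\gamma=\Diamond\Box\perp\vee(\Diamond p\rightarrow\Box p)$, $\delta^k_n=\Diamond^k\beta_n\wedge p\rightarrow\Diamond^n p$, $\varepsilon_n=\beta_n\wedge p\rightarrow\Box^n(\beta_n\wedge p)$. Then: (1) $\beta_n$ is valid at a world $w$ if, and only if, $w$ sees a dead end, sees in $n$ steps a world that sees a dead end, and does not see in any number $k\in\{2,\dots,n-1\}$ of steps a world that sees a dead end; (2) $\gamma$ is valid on a frame $\mathfrak{F}$ if, and only if, only those worlds of $\mathfrak{F}$ that see a dead end can see more than one world; (3) $\delta^k_n$ is valid on a frame $\mathfrak{F}$ if, and only if, every world of $\mathfrak{F}$ that can see in $k$ steps a world at which $\beta_n$ is true can see itself in $n$ steps; (4) $\varepsilon_n$ is valid on a frame $\mathfrak{F}$ if, and only if, every world $w$ of $\mathfrak{F}$ at which $\beta_n$ is true cannot see in $n$ steps a world $w'\neq w$.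
   Context: Modal formulas use $\neg,\wedge,\Box$, with $\Diamond=\neg\Box\neg$, $\perp$ a contradiction, a propositional variable being a 0-ary predicate letter; $\Box^0\psi=\Diamond^0\psi=\psi$, $\Box^{m+1}\psi=\Box\Box^m\psi$, $\Diamond^{m+1}\psi=\Diamond\Diamond^m\psi$. A frame is $\langle W,R\rangle$, $W\neq\emptyset$; $w$ sees $w'$ if $wRw'$, sees $w'$ in $m$ steps if there is an $R$-path of length $m$ from $w$ to $w'$; $w$ is a dead end if it sees no world. A formula is valid at a world $w$ of a frame if it is true at $w$ in every model (interpretation of predicate letters, over any expanding-domain predicate frame) based on the frame; valid on the frame if valid at every world. Since $\beta_n$ contains no predicate letters its truth at a world does not depend on the model. -}

module Defs where

open import Data.Nat using (ℕ; zero; suc; _∸_; _+_)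
open import Data.List using (List; []; _∷_; applyUpTo; map)
open import Data.Product using (Σ; _×_; _,_)
open import Data.Empty using (⊥)
open import Relation.Nullary using (¬_)
open import Relation.Binary.PropositionalEquality using (_≡_)

data Fm : Set where
  var   : ℕ → Fm
  falsum : Fm
  ¬̇_    : Fm → Fm
  _∧̇_   : Fm → Fm → Fm
  □̇_    : Fm → Fm

infixr 6 _∧̇_
infixr 8 ¬̇_ □̇_

◇̇_ : Fm → Fm
◇̇ φ = ¬̇ □̇ ¬̇ φ
infixr 8 ◇̇_
infixr 4 _∨̇_
infixr 3 _⇒̇_

_∨̇_ : Fm → Fm → Fm
φ ∨̇ ψ = ¬̇ (¬̇ φ ∧̇ ¬̇ ψ)

_⇒̇_ : Fm → Fm → Fm
φ ⇒̇ ψ = ¬̇ (φ ∧̇ ¬̇ ψ)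

⊤̇ : Fm
⊤̇ = ¬̇ falsum

□^ : ℕ → Fm → Fm
□^ zero φ = φ
□^ (suc m) φ = □̇ (□^ m φ)

◇^ : ℕ → Fm → Fm
◇^ zero φ = φ
◇^ (suc m) φ = ◇̇ (◇^ m φ)

⋀ : List Fm → Fm
⋀ [] = ⊤̇
⋀ (φ ∷ φs) = φ ∧̇ ⋀ φs

p : Fm
p = var 0

◇□⊥ : Fm
◇□⊥ = ◇̇ □̇ falsum

β : ℕ → Fm
β n = ◇□⊥ ∧̇ ◇^ n ◇□⊥ ∧̇ ⋀ (map (λ k → ¬̇ ◇^ k ◇□⊥) (applyUpTo (λ i → 2 + i) (n ∸ 2)))

γ : Fm
γ = ◇□⊥ ∨̇ (◇̇ p ⇒̇ □̇ p)

δ : ℕ → ℕ → Fm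
δ k n = (◇^ k (β n) ∧̇ p) ⇒̇ ◇^ n p

ε : ℕ → Fm
ε n = (β n ∧̇ p) ⇒̇ □^ n (β n ∧̇ p)

-- Kripke frames (W nonempty)
record Frame : Set₁ where
  field
    W  : Set
    R  : W → W → Set
    w₀ : W

open Frame public

Valuation : Frame → Set₁
Valuation F = ℕ → W F → Set

Sat : (F : Frame) → Valuation F → W F → Fm → Set
Sat F V w (var i) = V i w
Sat F V w falsum = ⊥
Sat F V w (¬̇ φ) = ¬ Sat F V w φ
Sat F V w (φ ∧̇ ψ) = Sat F V w φ × Sat F V w ψ
Sat F V w (□̇ φ) = ∀ v → R F w v → Sat F V v φ

ValidAt : (F : Frame) → W F → Fm → Set₁
ValidAt F w φ = ∀ (V : Valuation F) → Sat F V w φ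

Valid : Frame → Fm → Set₁
Valid F φ = ∀ w → ValidAt F w φ

Steps : (F : Frame) → ℕ → W F → W F → Set
Steps F zero w v = w ≡ v
Steps F (suc m) w v = Σ (W F) λ u → R F w u × Steps F m u v

DeadEnd : (F : Frame) → W F → Set
DeadEnd F w = ¬ Σ (W F) (R F w)

SeesDeadEnd : (F : Frame) → W F → Set
SeesDeadEnd F w = Σ (W F) λ v → R F w v × DeadEnd F v

module Submission where

-- The proof works over an arbitrary Kripke frame and reasons classically
-- (excluded middle gives double-negation elimination, which is needed
-- because ◇ is defined as ¬□¬).  Combining them, the truth of β_n at a
--     world is equivalent to a purely frame-theoretic condition
--     (`BetaCondition`), independently of the valuation.
--   * Part (1) follows at once; in particular β_n is valid at a world as
--     soon as it is true there under a single valuation.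
--   * Parts (2)-(4): the "if" directions unfold the truth lemmas; the
--     "only if" directions refute a failure of the frame condition using the
--     valuation `only u` that makes p true exactly at the world u.

open import Defs
open import Level using (0ℓ)
open import Axiom.ExcludedMiddle using (ExcludedMiddle)
open import Axiom.DoubleNegationElimination using (DoubleNegationElimination; em⇒dne)
open import Data.Nat using (ℕ; zero; suc; _∸_; _+_; _≤_; _<_; z≤n; s≤s)
open import Data.List using (applyUpTo; map)
open import Data.Product using (Σ; _×_; _,_; proj₁; proj₂)
open import Data.Empty using (⊥-elim)
open import Relation.Nullary using (¬_; yes; no)
open import Relation.Binary.PropositionalEquality using (_≡_; _≢_; refl; sym; subst)
open import Function using (_∘_)
open import Function.Bundles using (_⇔_; mk⇔)
open Function.Bundles.Equivalence using (to; from)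

ReachesDeadEndSeer : (F : Frame) → ℕ → W F → Set
ReachesDeadEndSeer F m w = Σ (W F) λ v → Steps F m w v × SeesDeadEnd F v

BetaCondition : (F : Frame) → ℕ → W F → Set
BetaCondition F n w =
  SeesDeadEnd F w × ReachesDeadEndSeer F n w
  × ((k : ℕ) → 2 ≤ k → k < n → ¬ ReachesDeadEndSeer F k w)

-- The index shift behind the conjunction ⋀_{k=2}^{n-1}: quantifying over
-- i < n ∸ 2 at 2 + i is quantifying over 2 ≤ k < n.
shift-by-two : (P : ℕ → Set) (n : ℕ) →
  ((i : ℕ) → i < n ∸ 2 → P (2 + i)) ⇔ ((k : ℕ) → 2 ≤ k → k < n → P k)
shift-by-two P n = mk⇔ shifted unshifted
  where
  shifted : ((i : ℕ) → i < n ∸ 2 → P (2 + i)) → (k : ℕ) → 2 ≤ k → k < n → P k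
  shifted f (suc (suc i)) (s≤s (s≤s z≤n)) k<n = f i (lower k<n)
    where
    lower : ∀ {m} → suc (suc i) < m → i < m ∸ 2
    lower (s≤s (s≤s i<m)) = i<m

  unshifted : ((k : ℕ) → 2 ≤ k → k < n → P k) → (i : ℕ) → i < n ∸ 2 → P (2 + i)
  unshifted f i i<n∸2 = f (2 + i) (s≤s (s≤s z≤n)) (raise n i<n∸2)
    where
    raise : ∀ m → i < m ∸ 2 → 2 + i < m
    raise (suc (suc m)) i<m = s≤s (s≤s i<m)

-- Truth lemmas for a fixed frame and valuation.  Double-negation
-- elimination is needed to extract a witness from the truth of ◇φ = ¬□¬φ.
module Truth (dne : DoubleNegationElimination 0ℓ) (F : Frame) (V : Valuation F) where

  ◇-sat : ∀ w φ → Sat F V w (◇̇ φ) ⇔ (Σ (W F) λ v → R F w v × Sat F V v φ)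
  ◇-sat w φ = mk⇔ (λ h → dne λ none → h λ v r s → none (v , r , s))
                  (λ { (v , r , s) allFail → allFail v r s })

  ◇^-sat : ∀ m w φ → Sat F V w (◇^ m φ) ⇔ (Σ (W F) λ v → Steps F m w v × Sat F V v φ)
  ◇^-sat zero w φ = mk⇔ (λ s → w , refl , s) (λ { (.w , refl , s) → s })
  ◇^-sat (suc m) w φ = mk⇔ forward backward
    where
    forward : Sat F V w (◇^ (suc m) φ) → Σ (W F) λ v → Steps F (suc m) w v × Sat F V v φ
    forward h with to (◇-sat w (◇^ m φ)) h
    ... | u , r , s with to (◇^-sat m u φ) s
    ... | v , path , s' = v , (u , r , path) , s'

    backward : (Σ (W F) λ v → Steps F (suc m) w v × Sat F V v φ) → Sat F V w (◇^ (suc m) φ)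
    backward (v , (u , r , path) , s) =
      from (◇-sat w (◇^ m φ)) (u , r , from (◇^-sat m u φ) (v , path , s))

  □^-sat : ∀ m w φ → Sat F V w (□^ m φ) ⇔ (∀ v → Steps F m w v → Sat F V v φ)
  □^-sat zero w φ = mk⇔ (λ { s .w refl → s }) (λ h → h w refl)
  □^-sat (suc m) w φ =
    mk⇔ (λ { h v (u , r , path) → to (□^-sat m u φ) (h u r) v path })
        (λ h u r → from (□^-sat m u φ) λ v path → h v (u , r , path))

  ⇒-sat : ∀ w φ ψ → Sat F V w (φ ⇒̇ ψ) ⇔ (Sat F V w φ → Sat F V w ψ)
  ⇒-sat w φ ψ = mk⇔ (λ h s → dne λ ns → h (s , ns)) (λ f (s , ns) → ns (f s))

  ◇□⊥-sat : ∀ w → Sat F V w ◇□⊥ ⇔ SeesDeadEnd F w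
  ◇□⊥-sat w =
    mk⇔ (λ h → let (v , r , dead) = to (◇-sat w (□̇ falsum)) h
               in v , r , λ (u , r') → dead u r')
        (λ (v , r , dead) → from (◇-sat w (□̇ falsum)) (v , r , λ u r' → dead (u , r')))

  reaches-sat : ∀ m w → Sat F V w (◇^ m ◇□⊥) ⇔ ReachesDeadEndSeer F m w
  reaches-sat m w =
    mk⇔ (λ h → let (v , path , s) = to (◇^-sat m w ◇□⊥) h
               in v , path , to (◇□⊥-sat v) s)
        (λ (v , path , d) → from (◇^-sat m w ◇□⊥) (v , path , from (◇□⊥-sat v) d))

  ⋀-sat : ∀ (h : ℕ → Fm) (g : ℕ → ℕ) m w →
    Sat F V w (⋀ (map h (applyUpTo g m))) ⇔ (∀ i → i < m → Sat F V w (h (g i)))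
  ⋀-sat h g zero w = mk⇔ (λ _ i ()) (λ _ ())
  ⋀-sat h g (suc m) w = mk⇔ forward backward
    where
    rest : Sat F V w (⋀ (map h (applyUpTo (λ j → g (suc j)) m)))
           ⇔ (∀ i → i < m → Sat F V w (h (g (suc i))))
    rest = ⋀-sat h (λ j → g (suc j)) m w

    forward : Sat F V w (⋀ (map h (applyUpTo g (suc m)))) → ∀ i → i < suc m → Sat F V w (h (g i))
    forward (s , _) zero _ = s
    forward (_ , ss) (suc i) (s≤s i<m) = to rest ss i i<m

    backward : (∀ i → i < suc m → Sat F V w (h (g i))) → Sat F V w (⋀ (map h (applyUpTo g (suc m))))
    backward f = f zero (s≤s z≤n) , from rest λ i i<m → f (suc i) (s≤s i<m)

  gap-sat : ∀ n w →
    Sat F V w (⋀ (map (λ k → ¬̇ ◇^ k ◇□⊥) (applyUpTo (λ i → 2 + i) (n ∸ 2))))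
    ⇔ ((k : ℕ) → 2 ≤ k → k < n → ¬ ReachesDeadEndSeer F k w)
  gap-sat n w =
    mk⇔ (λ s → to shift (λ i i< r → to conj s i i< (from (reaches-sat (2 + i) w) r)))
        (λ f → from conj λ i i< s → from shift f i i< (to (reaches-sat (2 + i) w) s))
    where
    conj : Sat F V w (⋀ (map (λ k → ¬̇ ◇^ k ◇□⊥) (applyUpTo (λ i → 2 + i) (n ∸ 2))))
           ⇔ (∀ i → i < n ∸ 2 → ¬ Sat F V w (◇^ (2 + i) ◇□⊥))
    conj = ⋀-sat (λ k → ¬̇ ◇^ k ◇□⊥) (λ i → 2 + i) (n ∸ 2) w
    shift : (∀ i → i < n ∸ 2 → ¬ ReachesDeadEndSeer F (2 + i) w)
            ⇔ ((k : ℕ) → 2 ≤ k → k < n → ¬ ReachesDeadEndSeer F k w)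
    shift = shift-by-two (λ k → ¬ ReachesDeadEndSeer F k w) n

  β-sat : ∀ n w → Sat F V w (β n) ⇔ BetaCondition F n w
  β-sat n w =
    mk⇔ (λ (a , b , c) → to (◇□⊥-sat w) a , to (reaches-sat n w) b , to (gap-sat n w) c)
        (λ (a , b , c) → from (◇□⊥-sat w) a , from (reaches-sat n w) b , from (gap-sat n w) c)

only : (F : Frame) → W F → Valuation F
only F u _ x = x ≡ u

module Correspondence (lem : ExcludedMiddle 0ℓ) where

  private
    dne : DoubleNegationElimination 0ℓ
    dne = em⇒dne lem

  open Truth dne

  β-validAt : (F : Frame) (n : ℕ) (w : W F) → ValidAt F w (β n) ⇔ BetaCondition F n w
  β-validAt F n w = mk⇔ (λ valid → to (β-sat F (only F w) n w) (valid (only F w)))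
                        (λ cond V → from (β-sat F V n w) cond)

  -- Since β_n is letterless, truth under one valuation means validity.
  β-true⇒valid : (F : Frame) (V : Valuation F) (n : ℕ) (w : W F) →
    Sat F V w (β n) → ValidAt F w (β n)
  β-true⇒valid F V n w s = from (β-validAt F n w) (to (β-sat F V n w) s)

  γ-sat : (F : Frame) (V : Valuation F) (w : W F) →
    Sat F V w γ ⇔ (¬ SeesDeadEnd F w → Sat F V w (◇̇ p) → Sat F V w (□̇ p))
  γ-sat F V w = mk⇔
    (λ s noDeadEnd → to impl (dne λ notImp → s (noDeadEnd ∘ to (◇□⊥-sat F V w) , notImp)))
    (λ f (noDeadEnd , notImp) → notImp (from impl (f (noDeadEnd ∘ from (◇□⊥-sat F V w)))))
    where
    impl : Sat F V w (◇̇ p ⇒̇ □̇ p) ⇔ (Sat F V w (◇̇ p) → Sat F V w (□̇ p))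
    impl = ⇒-sat F V w (◇̇ p) (□̇ p)

  γ-valid : (F : Frame) →
    Valid F γ ⇔
      ((w : W F) → Σ (W F) (λ u → Σ (W F) (λ v → R F w u × R F w v × u ≢ v)) →
       SeesDeadEnd F w)
  γ-valid F = mk⇔ necessary sufficient
    where
    -- With p true only at u, ◇p → □p fails at any world seeing u and some v ≠ u.
    necessary : Valid F γ → (w : W F) →
      Σ (W F) (λ u → Σ (W F) (λ v → R F w u × R F w v × u ≢ v)) → SeesDeadEnd F w
    necessary valid w (u , v , wRu , wRv , u≢v) = dne λ noDeadEnd →
      u≢v (sym (to (γ-sat F V w) (valid w V) noDeadEnd (from (◇-sat F V w p) (u , wRu , refl)) v wRv))
      where
      V : Valuation F
      V = only F u

    sufficient : ((w : W F) →
      Σ (W F) (λ u → Σ (W F) (λ v → R F w u × R F w v × u ≢ v)) → SeesDeadEnd F w) →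
      Valid F γ
    sufficient cond w V = from (γ-sat F V w) λ noDeadEnd ◇p v wRv →
      let (u , wRu , pu) = to (◇-sat F V w p) ◇p in
      subst (λ x → Sat F V x p) (unique-successor noDeadEnd wRu wRv) pu
      where
      unique-successor : ∀ {u v} → ¬ SeesDeadEnd F w → R F w u → R F w v → u ≡ v
      unique-successor {u} {v} noDeadEnd wRu wRv with lem {u ≡ v}
      ... | yes u≡v = u≡v
      ... | no u≢v = ⊥-elim (noDeadEnd (cond w (u , v , wRu , wRv , u≢v)))

  δ-valid : (k n : ℕ) (F : Frame) →
    Valid F (δ k n) ⇔
      ((w : W F) → Σ (W F) (λ v → Steps F k w v × ValidAt F v (β n)) → Steps F n w w)
  δ-valid k n F = mk⇔ necessary sufficient
    where
    -- With p true only at w, ◇^n p at w says exactly that w returns to itself.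
    necessary : Valid F (δ k n) →
      (w : W F) → Σ (W F) (λ v → Steps F k w v × ValidAt F v (β n)) → Steps F n w w
    necessary valid w (v , path , vβ) =
      let (x , cycle , x≡w) = to (◇^-sat F V n w p) (to (⇒-sat F V w (◇^ k (β n) ∧̇ p) (◇^ n p)) (valid w V) premise)
      in subst (Steps F n w) x≡w cycle
      where
      V : Valuation F
      V = only F w
      premise : Sat F V w (◇^ k (β n) ∧̇ p)
      premise = from (◇^-sat F V k w (β n)) (v , path , vβ V) , refl

    sufficient : ((w : W F) →
      Σ (W F) (λ v → Steps F k w v × ValidAt F v (β n)) → Steps F n w w) →
      Valid F (δ k n)
    sufficient cond w V = from (⇒-sat F V w (◇^ k (β n) ∧̇ p) (◇^ n p)) λ (◇^kβ , pw) →
      let (v , path , vβ) = to (◇^-sat F V k w (β n)) ◇^kβ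
      in from (◇^-sat F V n w p) (w , cond w (v , path , β-true⇒valid F V n v vβ) , pw)

  ε-valid : (n : ℕ) (F : Frame) →
    Valid F (ε n) ⇔
      ((w : W F) → ValidAt F w (β n) → (w' : W F) → Steps F n w w' → w' ≡ w)
  ε-valid n F = mk⇔ necessary sufficient
    where
    -- With p true only at w, □^n p at w says every n-step successor is w.
    necessary : Valid F (ε n) →
      (w : W F) → ValidAt F w (β n) → (w' : W F) → Steps F n w w' → w' ≡ w
    necessary valid w wβ w' path =
      proj₂ (to (□^-sat F V n w (β n ∧̇ p)) (to (⇒-sat F V w (β n ∧̇ p) (□^ n (β n ∧̇ p))) (valid w V) (wβ V , refl)) w' path)
      where
      V : Valuation F
      V = only F w

    sufficient : ((w : W F) → ValidAt F w (β n) → (w' : W F) → Steps F n w w' → w' ≡ w) →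
      Valid F (ε n)
    sufficient cond w V = from (⇒-sat F V w (β n ∧̇ p) (□^ n (β n ∧̇ p))) λ βp →
      from (□^-sat F V n w (β n ∧̇ p)) λ w' path →
        subst (λ x → Sat F V x (β n ∧̇ p)) (sym (cond w (β-true⇒valid F V n w (proj₁ βp)) w' path)) βp

open Correspondence

lemma7 : ExcludedMiddle 0ℓ → (n : ℕ) → 1 ≤ n →
    ((F : Frame) (w : W F) →
        ValidAt F w (β n) ⇔
          (SeesDeadEnd F w
           × Σ (W F) (λ v → Steps F n w v × SeesDeadEnd F v)
           × ((k : ℕ) → 2 ≤ k → k < n →
                ¬ Σ (W F) (λ v → Steps F k w v × SeesDeadEnd F v))))
    × ((F : Frame) →
        Valid F γ ⇔
          ((w : W F) →
             Σ (W F) (λ u → Σ (W F) (λ v → R F w u × R F w v × u ≢ v)) →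
             SeesDeadEnd F w))
    × ((k : ℕ) → 1 ≤ k → (F : Frame) →
        Valid F (δ k n) ⇔
          ((w : W F) →
             Σ (W F) (λ v → Steps F k w v × ValidAt F v (β n)) →
             Steps F n w w))
    × ((F : Frame) →
        Valid F (ε n) ⇔
          ((w : W F) → ValidAt F w (β n) →
             (w' : W F) → Steps F n w w' → w' ≡ w))
lemma7 lem n _ =
    (λ F w → β-validAt lem F n w)
  , γ-valid lem
  , (λ k _ → δ-valid lem k n)
  , ε-valid lem n
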